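{- For every integer $n\ge 0$, \[ \binom{2n}{n}\sum_{k=0}^{n}\binom{n}{k}^2\binom{n+k}{n}\binom{n+2k}{n}=\binom{2n}{n}\sum_{k=0}^{n}(-1)^{n+k}\binom{n}{k}\binom{n+k}{n}^3. \]
   Context: $\binom{m}{j}$ is the usual binomial coefficient. -}

module Defs where

open import Data.Nat using (ℕ; zero; suc)
open import Data.Integer using (ℤ; +_; _+_)

sumTo : ℕ → (ℕ → ℤ) → ℤ
sumTo zero    f = f zero
sumTo (suc n) f = sumTo n f + f (suc n)

-- Both sums equal the double sum over j, k ≤ n of
--   (-1)^(n+k) C(n,k) C(n+k,k) · C(n,j) C(k,j) C(n+k+j,j).
-- Summing over j first gives the right-hand side by the identity
--   Σⱼ C(n,j) C(k,j) C(n+k+j,j) = C(n+k,k)²,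
-- proved by creative telescoping in k.  Summing over k first gives the left-hand side: trinomial
-- revision turns C(n+k,k) C(n+k+j,j) into C(n+j,j) C(n+j+k,n+j), and
--   Σₖ (-1)^(n+k) C(n,k) C(k,j) C(N+k,t+n) = C(n,j) C(N+j,t+j)
-- follows by induction on n from Pascal's rule.

module Submission where

open import Defs
open import Data.Nat as ℕ using (ℕ; zero; suc)
import Data.Nat.Properties as ℕₚ
open import Data.Nat.Combinatorics
  using (_C_; nCk+nC[k+1]≡[n+1]C[k+1]; k>n⇒nCk≡0; nC1≡n; nCk≡nC[n∸k])
open import Relation.Binary.PropositionalEquality
open ≡-Reasoning

module BinomialNat where
  open import Data.Nat using (_+_; _*_; _!)
  open import Data.Nat.Properties using (_!≢0; _!*_!≢0)
  open import Data.Nat.Tactic.RingSolver using (solve-∀)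

  [k+1]*[n+1]C[k+1]≡[n+1]*nCk : ∀ n k → suc k * (suc n C suc k) ≡ suc n * (n C k)
  [k+1]*[n+1]C[k+1]≡[n+1]*nCk n       zero    =
    trans (ℕₚ.+-identityʳ _) (trans (nC1≡n (suc n)) (sym (ℕₚ.*-identityʳ (suc n))))
  [k+1]*[n+1]C[k+1]≡[n+1]*nCk zero    (suc k) = ℕₚ.*-zeroʳ (suc (suc k))
  [k+1]*[n+1]C[k+1]≡[n+1]*nCk (suc n) (suc k) = begin
    suc (suc k) * (suc (suc n) C suc (suc k))
      ≡⟨ cong (suc (suc k) *_) (nCk+nC[k+1]≡[n+1]C[k+1] (suc n) (suc k)) ⟨
    suc (suc k) * (x + y)
      ≡⟨ regroup (suc k) x y ⟩
    x + (suc k * x + suc (suc k) * y)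
      ≡⟨ cong₂ (λ p q → x + (p + q))
               ([k+1]*[n+1]C[k+1]≡[n+1]*nCk n k) ([k+1]*[n+1]C[k+1]≡[n+1]*nCk n (suc k)) ⟩
    x + (suc n * (n C k) + suc n * (n C suc k))
      ≡⟨ cong (x +_) (sym (ℕₚ.*-distribˡ-+ (suc n) (n C k) (n C suc k))) ⟩
    x + suc n * (n C k + n C suc k)
      ≡⟨ cong (λ p → x + suc n * p) (nCk+nC[k+1]≡[n+1]C[k+1] n k) ⟩
    suc (suc n) * x ∎
    where
    x = suc n C suc k
    y = suc n C suc (suc k)
    regroup : ∀ k x y → suc k * (x + y) ≡ x + (k * x + suc k * y)
    regroup = solve-∀

  [a+b]Cb*a!*b!≡[a+b]! : ∀ a b → ((a + b) C b) * (a ! * b !) ≡ (a + b) !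
  [a+b]Cb*a!*b!≡[a+b]! a zero rewrite ℕₚ.+-identityʳ a = trans (ℕₚ.*-identityˡ (a ! * 1)) (ℕₚ.*-identityʳ (a !))
  [a+b]Cb*a!*b!≡[a+b]! a (suc b) rewrite ℕₚ.+-suc a b = begin
    (suc (a + b) C suc b) * (a ! * (suc b * b !))
      ≡⟨ regroup (suc (a + b) C suc b) (a !) (suc b) (b !) ⟩
    suc b * (suc (a + b) C suc b) * (a ! * b !)
      ≡⟨ cong (_* (a ! * b !)) ([k+1]*[n+1]C[k+1]≡[n+1]*nCk (a + b) b) ⟩
    suc (a + b) * ((a + b) C b) * (a ! * b !)
      ≡⟨ ℕₚ.*-assoc (suc (a + b)) ((a + b) C b) (a ! * b !) ⟩
    suc (a + b) * (((a + b) C b) * (a ! * b !))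
      ≡⟨ cong (suc (a + b) *_) ([a+b]Cb*a!*b!≡[a+b]! a b) ⟩
    suc (a + b) * (a + b) ! ∎
    where
    regroup : ∀ x p s q → x * (p * (s * q)) ≡ s * x * (p * q)
    regroup = solve-∀

  [a+b]Cb≡[a+b]Ca : ∀ a b → (a + b) C b ≡ (a + b) C a
  [a+b]Cb≡[a+b]Ca a b = trans (nCk≡nC[n∸k] (ℕₚ.m≤n+m b a)) (cong ((a + b) C_) (ℕₚ.m+n∸n≡m a b))

  [a+b]Cb*[a+b+c]Cc*a!*b!*c!≡[a+b+c]! : ∀ a b c →
    ((a + b) C b) * ((a + b + c) C c) * (a ! * b ! * c !) ≡ (a + b + c) !
  [a+b]Cb*[a+b+c]Cc*a!*b!*c!≡[a+b+c]! a b c = begin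
    ((a + b) C b) * ((a + b + c) C c) * (a ! * b ! * c !)
      ≡⟨ regroup ((a + b) C b) ((a + b + c) C c) (a !) (b !) (c !) ⟩
    ((a + b + c) C c) * ((((a + b) C b) * (a ! * b !)) * c !)
      ≡⟨ cong (λ x → ((a + b + c) C c) * (x * c !)) ([a+b]Cb*a!*b!≡[a+b]! a b) ⟩
    ((a + b + c) C c) * ((a + b) ! * c !)
      ≡⟨ [a+b]Cb*a!*b!≡[a+b]! (a + b) c ⟩
    (a + b + c) ! ∎
    where
    regroup : ∀ x y p q r → x * y * (p * q * r) ≡ y * ((x * (p * q)) * r)
    regroup = solve-∀

  [a+b]Cb*[a+b+c]Cc≡[a+c]Cc*[a+c+b]Cb : ∀ a b c →
    ((a + b) C b) * ((a + b + c) C c) ≡ ((a + c) C c) * ((a + c + b) C b)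
  [a+b]Cb*[a+b+c]Cc≡[a+c]Cc*[a+c+b]Cb a b c =
    ℕₚ.*-cancelʳ-≡ _ _ (a ! * b ! * c !) {{ℕₚ.m*n≢0 (a ! * b !) (c !) {{a !* b !≢0}} {{c !≢0}}}} (begin
      ((a + b) C b) * ((a + b + c) C c) * (a ! * b ! * c !)
        ≡⟨ [a+b]Cb*[a+b+c]Cc*a!*b!*c!≡[a+b+c]! a b c ⟩
      (a + b + c) !
        ≡⟨ cong _! (+-right-comm a b c) ⟩
      (a + c + b) !
        ≡⟨ [a+b]Cb*[a+b+c]Cc*a!*b!*c!≡[a+b+c]! a c b ⟨
      ((a + c) C c) * ((a + c + b) C b) * (a ! * c ! * b !)
        ≡⟨ cong (((a + c) C c) * ((a + c + b) C b) *_) (*-right-comm (a !) (c !) (b !)) ⟩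
      ((a + c) C c) * ((a + c + b) C b) * (a ! * b ! * c !) ∎)
    where
    +-right-comm : ∀ x y z → x + y + z ≡ x + z + y
    +-right-comm = solve-∀
    *-right-comm : ∀ x y z → x * y * z ≡ x * z * y
    *-right-comm = solve-∀

open BinomialNat

open import Data.Integer using (ℤ; +_; -_; _+_; _-_; _*_; _^_; 0ℤ; -1ℤ)
import Data.Integer.Properties as ℤₚ
open import Data.Integer.Tactic.RingSolver using (solve; solve-∀)
open import Data.List using (_∷_; [])
import Data.Nat.Tactic.RingSolver as ℕ-Solver
open import Algebra.Properties.CommutativeSemigroup ℤₚ.+-commutativeSemigroup
  using (x∙yz≈y∙xz) renaming (interchange to +-interchange)
open import Algebra.Properties.AbelianGroup ℤₚ.+-0-abelianGroup
  using () renaming (∙-cancelʳ to +-cancelʳ)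

sumTo-cong : ∀ n {f g : ℕ → ℤ} → (∀ k → f k ≡ g k) → sumTo n f ≡ sumTo n g
sumTo-cong zero    f≗g = f≗g zero
sumTo-cong (suc n) f≗g = cong₂ _+_ (sumTo-cong n f≗g) (f≗g (suc n))

sumTo-+ : ∀ n (f g : ℕ → ℤ) → sumTo n (λ k → f k + g k) ≡ sumTo n f + sumTo n g
sumTo-+ zero    f g = refl
sumTo-+ (suc n) f g =
  trans (cong (_+ (f (suc n) + g (suc n))) (sumTo-+ n f g)) (+-interchange (sumTo n f) (sumTo n g) _ _)

*-distribˡ-sumTo : ∀ n c (f : ℕ → ℤ) → c * sumTo n f ≡ sumTo n (λ k → c * f k)
*-distribˡ-sumTo zero    c f = refl
*-distribˡ-sumTo (suc n) c f =
  trans (ℤₚ.*-distribˡ-+ c (sumTo n f) (f (suc n))) (cong (_+ c * f (suc n)) (*-distribˡ-sumTo n c f))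

sumTo-swap : ∀ m n (f : ℕ → ℕ → ℤ) →
  sumTo m (λ i → sumTo n (f i)) ≡ sumTo n (λ j → sumTo m (λ i → f i j))
sumTo-swap zero    n f = refl
sumTo-swap (suc m) n f = trans (cong (_+ sumTo n (f (suc m))) (sumTo-swap m n f))
  (sym (sumTo-+ n (λ j → sumTo m (λ i → f i j)) (f (suc m))))

sumTo-shift : ∀ n (f : ℕ → ℤ) → sumTo (suc n) f ≡ f 0 + sumTo n (λ k → f (suc k))
sumTo-shift zero    f = refl
sumTo-shift (suc n) f = trans (cong (_+ f (suc (suc n))) (sumTo-shift n f)) (ℤₚ.+-assoc (f 0) _ _)

sumTo-head : ∀ n (f : ℕ → ℤ) → (∀ k → f (suc k) ≡ 0ℤ) → sumTo n f ≡ f 0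
sumTo-head zero    f f[1+k]≡0 = refl
sumTo-head (suc n) f f[1+k]≡0 =
  trans (cong₂ _+_ (sumTo-head n f f[1+k]≡0) (f[1+k]≡0 n)) (ℤₚ.+-identityʳ (f 0))

sumTo-telescoping : ∀ n (f g h : ℕ → ℤ) → h 0 ≡ 0ℤ → h (suc n) ≡ 0ℤ →
  (∀ j → f j + h (suc j) ≡ g j + h j) → sumTo n f ≡ sumTo n g
sumTo-telescoping n f g h h0≡0 h[1+n]≡0 step = +-cancelʳ (sumTo n h) _ _ (begin
  sumTo n f + sumTo n h                       ≡⟨ cong (λ x → sumTo n f + x) shift ⟨
  sumTo n f + sumTo n (λ j → h (suc j))       ≡⟨ sumTo-+ n f (λ j → h (suc j)) ⟨
  sumTo n (λ j → f j + h (suc j))             ≡⟨ sumTo-cong n step ⟩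
  sumTo n (λ j → g j + h j)                   ≡⟨ sumTo-+ n g h ⟩
  sumTo n g + sumTo n h                       ∎)
  where
  shift : sumTo n (λ j → h (suc j)) ≡ sumTo n h
  shift = begin
    sumTo n (λ j → h (suc j))         ≡⟨ ℤₚ.+-identityˡ _ ⟨
    0ℤ + sumTo n (λ j → h (suc j))    ≡⟨ cong (_+ sumTo n (λ j → h (suc j))) h0≡0 ⟨
    h 0 + sumTo n (λ j → h (suc j))   ≡⟨ sumTo-shift n h ⟨
    sumTo n h + h (suc n)             ≡⟨ cong (λ x → sumTo n h + x) h[1+n]≡0 ⟩
    sumTo n h + 0ℤ                    ≡⟨ ℤₚ.+-identityʳ (sumTo n h) ⟩
    sumTo n h                         ∎

binom : ℕ → ℕ → ℤ
binom n k = + (n C k)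

binom-pascal : ∀ n k → binom (suc n) (suc k) ≡ binom n k + binom n (suc k)
binom-pascal n k = trans (cong +_ (sym (nCk+nC[k+1]≡[n+1]C[k+1] n k))) (ℤₚ.pos-+ (n C k) (n C suc k))

binom-absorption : ∀ n k → + suc k * binom (suc n) (suc k) ≡ + suc n * binom n k
binom-absorption n k = begin
  + suc k * binom (suc n) (suc k)   ≡⟨ ℤₚ.pos-* (suc k) (suc n C suc k) ⟨
  + (suc k ℕ.* (suc n C suc k))     ≡⟨ cong +_ ([k+1]*[n+1]C[k+1]≡[n+1]*nCk n k) ⟩
  + (suc n ℕ.* (n C k))             ≡⟨ ℤₚ.pos-* (suc n) (n C k) ⟩
  + suc n * binom n k               ∎

binom-step : ∀ n k → + suc k * binom n (suc k) ≡ (+ n - + k) * binom n k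
binom-step n k = step (+ n) (+ k) (binom n k) (binom n (suc k))
  (trans (cong (+ suc k *_) (sym (binom-pascal n k))) (binom-absorption n k))
  where
  step : ∀ N K x y → (+ 1 + K) * (x + y) ≡ (+ 1 + N) * x → (+ 1 + K) * y ≡ (N - K) * x
  step N K x y eq = begin
    (+ 1 + K) * y                        ≡⟨ solve (K ∷ x ∷ y ∷ []) ⟩
    (+ 1 + K) * (x + y) - (+ 1 + K) * x  ≡⟨ cong (_- (+ 1 + K) * x) eq ⟩
    (+ 1 + N) * x - (+ 1 + K) * x        ≡⟨ solve (N ∷ K ∷ x ∷ []) ⟩
    (N - K) * x                          ∎

binom-vanishes : ∀ n → binom n (suc n) ≡ 0ℤ
binom-vanishes n = cong +_ (k>n⇒nCk≡0 (ℕₚ.n<1+n n))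

sumTo-binom-pascal : ∀ n (g : ℕ → ℤ) →
  sumTo (suc n) (λ k → binom (suc n) k * g k) ≡ sumTo n (λ k → binom n k * (g k + g (suc k)))
sumTo-binom-pascal n g = begin
  sumTo (suc n) (λ k → binom (suc n) k * g k)              ≡⟨ sumTo-shift n _ ⟩
  g₀ + sumTo n (λ k → binom (suc n) (suc k) * g (suc k))   ≡⟨ cong (_+_ g₀) (trans (sumTo-cong n split) (sumTo-+ n _ _)) ⟩
  g₀ + (A + B)                                             ≡⟨ x∙yz≈y∙xz g₀ A B ⟩
  A + (g₀ + B)                                             ≡⟨ cong (_+_ A) (sumTo-shift n _) ⟨
  A + sumTo (suc n) (λ k → binom n k * g k)                ≡⟨ cong (λ x → A + (S + x * g (suc n))) (binom-vanishes n) ⟩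
  A + (S + 0ℤ)                                             ≡⟨ cong (_+_ A) (ℤₚ.+-identityʳ S) ⟩
  A + S                                                    ≡⟨ ℤₚ.+-comm A S ⟩
  S + A                                                    ≡⟨ sumTo-+ n _ _ ⟨
  sumTo n (λ k → binom n k * g k + binom n k * g (suc k))  ≡⟨ sumTo-cong n (λ k → ℤₚ.*-distribˡ-+ (binom n k) _ _) ⟨
  sumTo n (λ k → binom n k * (g k + g (suc k)))            ∎
  where
  g₀ = binom (suc n) 0 * g 0
  A  = sumTo n (λ k → binom n k * g (suc k))
  B  = sumTo n (λ k → binom n (suc k) * g (suc k))
  S  = sumTo n (λ k → binom n k * g k)
  split : ∀ k → binom (suc n) (suc k) * g (suc k) ≡ binom n k * g (suc k) + binom n (suc k) * g (suc k)
  split k = trans (cong (_* g (suc k)) (binom-pascal n k)) (ℤₚ.*-distribʳ-+ (g (suc k)) (binom n k) (binom n (suc k)))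

-- The factor C(n,k) of the summand is kept outside, so that sumTo-binom-pascal drives the induction on n.
alternatingWeight : ℕ → ℕ → ℕ → ℕ → ℕ → ℤ
alternatingWeight n j N t k = -1ℤ ^ (n ℕ.+ k) * (binom k j * binom (N ℕ.+ k) (t ℕ.+ n))

alternatingWeight-adjacent : ∀ n j N t k →
  alternatingWeight (suc n) j N t k + alternatingWeight (suc n) j N t (suc k)
    ≡ -1ℤ ^ (n ℕ.+ k) * (binom (suc k) j * binom (suc (N ℕ.+ k)) (suc (t ℕ.+ n))
                         - binom k j * binom (N ℕ.+ k) (suc (t ℕ.+ n)))
alternatingWeight-adjacent n j N t k rewrite ℕₚ.+-suc n k | ℕₚ.+-suc N k | ℕₚ.+-suc t n =
  identity (-1ℤ ^ (n ℕ.+ k)) (binom k j) (binom (suc k) j) _ _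
  where
  identity : ∀ σ B B′ P Q → -1ℤ * σ * (B * Q) + -1ℤ * (-1ℤ * σ) * (B′ * P) ≡ σ * (B′ * P - B * Q)
  identity = solve-∀

alternatingWeight-pascal₀ : ∀ n N t k →
  alternatingWeight (suc n) 0 N t k + alternatingWeight (suc n) 0 N t (suc k) ≡ alternatingWeight n 0 N t k
alternatingWeight-pascal₀ n N t k = begin
  alternatingWeight (suc n) 0 N t k + alternatingWeight (suc n) 0 N t (suc k)
    ≡⟨ alternatingWeight-adjacent n 0 N t k ⟩
  σ * (+ 1 * binom (suc (N ℕ.+ k)) (suc (t ℕ.+ n)) - + 1 * Q)
    ≡⟨ cong (λ x → σ * (+ 1 * x - + 1 * Q)) (binom-pascal (N ℕ.+ k) (t ℕ.+ n)) ⟩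
  σ * (+ 1 * (P + Q) - + 1 * Q)
    ≡⟨ identity σ P Q ⟩
  σ * (+ 1 * P) ∎
  where
  identity : ∀ σ P Q → σ * (+ 1 * (P + Q) - + 1 * Q) ≡ σ * (+ 1 * P)
  identity = solve-∀
  σ = -1ℤ ^ (n ℕ.+ k)
  P = binom (N ℕ.+ k) (t ℕ.+ n)
  Q = binom (N ℕ.+ k) (suc (t ℕ.+ n))

alternatingWeight-pascal : ∀ n j N t k →
  alternatingWeight (suc n) (suc j) N t k + alternatingWeight (suc n) (suc j) N t (suc k)
    ≡ alternatingWeight n (suc j) N t k + alternatingWeight n j (suc N) (suc t) k
alternatingWeight-pascal n j N t k = begin
  alternatingWeight (suc n) (suc j) N t k + alternatingWeight (suc n) (suc j) N t (suc k)
    ≡⟨ alternatingWeight-adjacent n (suc j) N t k ⟩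
  σ * (binom (suc k) (suc j) * binom (suc (N ℕ.+ k)) (suc (t ℕ.+ n)) - B′ * Q)
    ≡⟨ cong₂ (λ x y → σ * (x * y - B′ * Q)) (binom-pascal k j) (binom-pascal (N ℕ.+ k) (t ℕ.+ n)) ⟩
  σ * ((B + B′) * (P + Q) - B′ * Q)
    ≡⟨ identity σ B B′ P Q ⟩
  σ * (B′ * P) + σ * (B * (P + Q))
    ≡⟨ cong (λ x → σ * (B′ * P) + σ * (B * x)) (binom-pascal (N ℕ.+ k) (t ℕ.+ n)) ⟨
  alternatingWeight n (suc j) N t k + alternatingWeight n j (suc N) (suc t) k ∎
  where
  σ  = -1ℤ ^ (n ℕ.+ k)
  B  = binom k j
  B′ = binom k (suc j)
  P  = binom (N ℕ.+ k) (t ℕ.+ n)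
  Q  = binom (N ℕ.+ k) (suc (t ℕ.+ n))
  identity : ∀ σ B B′ P Q → σ * ((B + B′) * (P + Q) - B′ * Q) ≡ σ * (B′ * P) + σ * (B * (P + Q))
  identity = solve-∀

alternating-sum : ∀ n j N t →
  sumTo n (λ k → binom n k * alternatingWeight n j N t k) ≡ binom n j * binom (N ℕ.+ j) (t ℕ.+ j)
alternating-sum zero    zero    N t = trans (ℤₚ.*-identityˡ _) (ℤₚ.*-identityˡ _)
alternating-sum zero    (suc j) N t = refl
alternating-sum (suc n) zero    N t = begin
  sumTo (suc n) (λ k → binom (suc n) k * w k)
    ≡⟨ sumTo-binom-pascal n w ⟩
  sumTo n (λ k → binom n k * (w k + w (suc k)))
    ≡⟨ sumTo-cong n (λ k → cong (binom n k *_) (alternatingWeight-pascal₀ n N t k)) ⟩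
  sumTo n (λ k → binom n k * alternatingWeight n 0 N t k)
    ≡⟨ alternating-sum n 0 N t ⟩
  binom (suc n) 0 * binom (N ℕ.+ 0) (t ℕ.+ 0) ∎
  where
  w = alternatingWeight (suc n) 0 N t
alternating-sum (suc n) (suc j) N t = begin
  sumTo (suc n) (λ k → binom (suc n) k * w k)
    ≡⟨ sumTo-binom-pascal n w ⟩
  sumTo n (λ k → binom n k * (w k + w (suc k)))
    ≡⟨ sumTo-cong n (λ k → trans (cong (binom n k *_) (alternatingWeight-pascal n j N t k)) (ℤₚ.*-distribˡ-+ (binom n k) _ _)) ⟩
  sumTo n (λ k → binom n k * w₁ k + binom n k * w₂ k)
    ≡⟨ sumTo-+ n _ _ ⟩
  sumTo n (λ k → binom n k * w₁ k) + sumTo n (λ k → binom n k * w₂ k)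
    ≡⟨ cong₂ _+_ (alternating-sum n (suc j) N t) (alternating-sum n j (suc N) (suc t)) ⟩
  binom n (suc j) * X + binom n j * binom (suc N ℕ.+ j) (suc t ℕ.+ j)
    ≡⟨ cong₂ (λ a b → binom n (suc j) * X + binom n j * binom a b) (ℕₚ.+-suc N j) (ℕₚ.+-suc t j) ⟨
  binom n (suc j) * X + binom n j * X
    ≡⟨ ℤₚ.+-comm (binom n (suc j) * X) (binom n j * X) ⟩
  binom n j * X + binom n (suc j) * X
    ≡⟨ ℤₚ.*-distribʳ-+ X (binom n j) (binom n (suc j)) ⟨
  (binom n j + binom n (suc j)) * X
    ≡⟨ cong (_* X) (binom-pascal n j) ⟨
  binom (suc n) (suc j) * X ∎
  where
  w  = alternatingWeight (suc n) (suc j) N t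
  w₁ = alternatingWeight n (suc j) N t
  w₂ = alternatingWeight n j (suc N) (suc t)
  X  = binom (N ℕ.+ suc j) (t ℕ.+ suc j)

squareTerm : ℕ → ℕ → ℕ → ℤ
squareTerm n k j = binom n j * binom k j * binom (n ℕ.+ k ℕ.+ j) j

-- Creative-telescoping certificate G(j) = (n+2k+2) j C(n,j) C(k,j-1) C(n+k+j,j-1), with G(0) = 0.
squareCertificate : ℕ → ℕ → ℕ → ℤ
squareCertificate n k zero    = 0ℤ
squareCertificate n k (suc i) =
  + (2 ℕ.+ n ℕ.+ k ℕ.+ k) * + suc i * binom n (suc i) * binom k i * binom (n ℕ.+ k ℕ.+ suc i) i

-- With m = n+k+i+1, the variables stand for X₁ = C(n,i+1), X₂ = C(n,i+2), Y₀ = C(k,i), Y₁ = C(k,i+1),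
-- Z₀ = C(m,i), Z₁ = C(m+1,i+1), W₁ = C(m,i+1), and the hypotheses relate neighbouring binomials.
-- Multiplied by (i+1)², both sides become X₁ Y₀ Z₀ times the same polynomial in n, k, i.
squareCertificate-identity : ∀ (n k i X₁ X₂ Y₀ Y₁ Z₀ Z₁ W₁ : ℤ) →
  (+ 2 + i) * X₂ ≡ (n - (+ 1 + i)) * X₁ →
  (+ 1 + i) * Y₁ ≡ (k - i) * Y₀ →
  (+ 1 + i) * Z₁ ≡ (+ 1 + (n + k + (+ 1 + i))) * Z₀ →
  (+ 1 + i) * W₁ ≡ (n + k + (+ 1 + i) - i) * Z₀ →
  (+ 1 + i) * (+ 1 + i) * ((+ 1 + k) * (+ 1 + k) * (X₁ * (Y₀ + Y₁) * Z₁) + (+ 2 + n + k + k) * (+ 2 + i) * X₂ * Y₁ * Z₁)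
    ≡ (+ 1 + i) * (+ 1 + i) * ((+ 1 + (n + k)) * (+ 1 + (n + k)) * (X₁ * Y₁ * W₁) + (+ 2 + n + k + k) * (+ 1 + i) * X₁ * Y₀ * Z₀)
squareCertificate-identity n k i X₁ X₂ Y₀ Y₁ Z₀ Z₁ W₁ hX hY hZ hW = begin
  (+ 1 + i) * (+ 1 + i) * ((+ 1 + k) * (+ 1 + k) * (X₁ * (Y₀ + Y₁) * Z₁) + (+ 2 + n + k + k) * (+ 2 + i) * X₂ * Y₁ * Z₁)
    ≡⟨ solve (n ∷ k ∷ i ∷ X₁ ∷ X₂ ∷ Y₀ ∷ Y₁ ∷ Z₁ ∷ []) ⟩
  (+ 1 + k) * (+ 1 + k) * (X₁ * ((+ 1 + i) * Y₀ + (+ 1 + i) * Y₁) * ((+ 1 + i) * Z₁))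
    + (+ 2 + n + k + k) * ((+ 2 + i) * X₂) * ((+ 1 + i) * Y₁) * ((+ 1 + i) * Z₁)
    ≡⟨ cong₂ (λ y z → (+ 1 + k) * (+ 1 + k) * (X₁ * ((+ 1 + i) * Y₀ + y) * z) + (+ 2 + n + k + k) * ((+ 2 + i) * X₂) * y * z) hY hZ ⟩
  (+ 1 + k) * (+ 1 + k) * (X₁ * ((+ 1 + i) * Y₀ + (k - i) * Y₀) * ((+ 1 + (n + k + (+ 1 + i))) * Z₀))
    + (+ 2 + n + k + k) * ((+ 2 + i) * X₂) * ((k - i) * Y₀) * ((+ 1 + (n + k + (+ 1 + i))) * Z₀)
    ≡⟨ cong (λ x → (+ 1 + k) * (+ 1 + k) * (X₁ * ((+ 1 + i) * Y₀ + (k - i) * Y₀) * ((+ 1 + (n + k + (+ 1 + i))) * Z₀))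
                     + (+ 2 + n + k + k) * x * ((k - i) * Y₀) * ((+ 1 + (n + k + (+ 1 + i))) * Z₀)) hX ⟩
  (+ 1 + k) * (+ 1 + k) * (X₁ * ((+ 1 + i) * Y₀ + (k - i) * Y₀) * ((+ 1 + (n + k + (+ 1 + i))) * Z₀))
    + (+ 2 + n + k + k) * ((n - (+ 1 + i)) * X₁) * ((k - i) * Y₀) * ((+ 1 + (n + k + (+ 1 + i))) * Z₀)
    ≡⟨ solve (n ∷ k ∷ i ∷ X₁ ∷ Y₀ ∷ Z₀ ∷ []) ⟩
  (+ 1 + (n + k)) * (+ 1 + (n + k)) * (X₁ * ((k - i) * Y₀) * ((n + k + (+ 1 + i) - i) * Z₀))
    + (+ 1 + i) * (+ 1 + i) * ((+ 2 + n + k + k) * (+ 1 + i) * X₁ * Y₀ * Z₀)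
    ≡⟨ cong₂ (λ y w → (+ 1 + (n + k)) * (+ 1 + (n + k)) * (X₁ * y * w) + (+ 1 + i) * (+ 1 + i) * ((+ 2 + n + k + k) * (+ 1 + i) * X₁ * Y₀ * Z₀)) hY hW ⟨
  (+ 1 + (n + k)) * (+ 1 + (n + k)) * (X₁ * ((+ 1 + i) * Y₁) * ((+ 1 + i) * W₁))
    + (+ 1 + i) * (+ 1 + i) * ((+ 2 + n + k + k) * (+ 1 + i) * X₁ * Y₀ * Z₀)
    ≡⟨ solve (n ∷ k ∷ i ∷ X₁ ∷ Y₀ ∷ Y₁ ∷ Z₀ ∷ W₁ ∷ []) ⟩
  (+ 1 + i) * (+ 1 + i) * ((+ 1 + (n + k)) * (+ 1 + (n + k)) * (X₁ * Y₁ * W₁) + (+ 2 + n + k + k) * (+ 1 + i) * X₁ * Y₀ * Z₀) ∎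

squareTerm-recurrence : ∀ n k j →
  + suc k * + suc k * squareTerm n (suc k) j + squareCertificate n k (suc j)
    ≡ + suc (n ℕ.+ k) * + suc (n ℕ.+ k) * squareTerm n k j + squareCertificate n k j
squareTerm-recurrence n k zero = begin
  + suc k * + suc k * (+ 1 * + 1 * + 1) + M * + 1 * binom n 1 * + 1 * + 1
    ≡⟨ cong (λ x → + suc k * + suc k * (+ 1 * + 1 * + 1) + M * + 1 * + x * + 1 * + 1) (nC1≡n n) ⟩
  + suc k * + suc k * (+ 1 * + 1 * + 1) + M * + 1 * + n * + 1 * + 1
    ≡⟨ identity (+ n) (+ k) ⟩
  + suc (n ℕ.+ k) * + suc (n ℕ.+ k) * (+ 1 * + 1 * + 1) + 0ℤ ∎
  where
  M = + (2 ℕ.+ n ℕ.+ k ℕ.+ k)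
  identity : ∀ n k → (+ 1 + k) * (+ 1 + k) * (+ 1 * + 1 * + 1) + (+ 2 + n + k + k) * + 1 * n * + 1 * + 1
                   ≡ (+ 1 + (n + k)) * (+ 1 + (n + k)) * (+ 1 * + 1 * + 1) + 0ℤ
  identity = solve-∀
squareTerm-recurrence n k (suc i) = ℤₚ.*-cancelˡ-≡ (+ suc i * + suc i) _ _ (begin
  + suc i * + suc i * (+ suc k * + suc k * (X₁ * binom (suc k) (suc i) * binom (n ℕ.+ suc k ℕ.+ suc i) (suc i))
                        + M * + suc (suc i) * X₂ * Y₁ * binom (n ℕ.+ k ℕ.+ suc (suc i)) (suc i))
    ≡⟨ cong₂ (λ y z → + suc i * + suc i * (+ suc k * + suc k * (X₁ * y * z) + M * + suc (suc i) * X₂ * Y₁ * binom (n ℕ.+ k ℕ.+ suc (suc i)) (suc i)))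
             (binom-pascal k i) (cong (λ a → binom (a ℕ.+ suc i) (suc i)) (ℕₚ.+-suc n k)) ⟩
  + suc i * + suc i * (+ suc k * + suc k * (X₁ * (Y₀ + Y₁) * Z₁)
                        + M * + suc (suc i) * X₂ * Y₁ * binom (n ℕ.+ k ℕ.+ suc (suc i)) (suc i))
    ≡⟨ cong (λ z → + suc i * + suc i * (+ suc k * + suc k * (X₁ * (Y₀ + Y₁) * Z₁) + M * + suc (suc i) * X₂ * Y₁ * binom z (suc i)))
            (ℕₚ.+-suc (n ℕ.+ k) (suc i)) ⟩
  + suc i * + suc i * (+ suc k * + suc k * (X₁ * (Y₀ + Y₁) * Z₁) + M * + suc (suc i) * X₂ * Y₁ * Z₁)
    ≡⟨ squareCertificate-identity (+ n) (+ k) (+ i) X₁ X₂ Y₀ Y₁ Z₀ Z₁ W₁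
         (binom-step n (suc i)) (binom-step k i) (binom-absorption m i) (binom-step m i) ⟩
  + suc i * + suc i * (+ suc (n ℕ.+ k) * + suc (n ℕ.+ k) * (X₁ * Y₁ * W₁) + M * + suc i * X₁ * Y₀ * Z₀) ∎)
  where
  m  = n ℕ.+ k ℕ.+ suc i
  M  = + (2 ℕ.+ n ℕ.+ k ℕ.+ k)
  X₁ = binom n (suc i)
  X₂ = binom n (suc (suc i))
  Y₀ = binom k i
  Y₁ = binom k (suc i)
  Z₀ = binom m i
  Z₁ = binom (suc m) (suc i)
  W₁ = binom m (suc i)

squareCertificate-vanishes : ∀ n k → squareCertificate n k (suc n) ≡ 0ℤ
squareCertificate-vanishes n k =
  cong (λ x → x * binom k n * binom (n ℕ.+ k ℕ.+ suc n) n)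
       (trans (cong (_*_ c) (binom-vanishes n)) (ℤₚ.*-zeroʳ c))
  where
  c = + (2 ℕ.+ n ℕ.+ k ℕ.+ k) * + suc n

squareTerm-sum : ∀ n k → sumTo n (squareTerm n k) ≡ binom (n ℕ.+ k) k * binom (n ℕ.+ k) k
squareTerm-sum n zero = sumTo-head n (squareTerm n 0)
  (λ j → cong (_* binom (n ℕ.+ 0 ℕ.+ suc j) (suc j)) (ℤₚ.*-zeroʳ (binom n (suc j))))
squareTerm-sum n (suc k) = ℤₚ.*-cancelˡ-≡ (+ suc k * + suc k) _ _ (begin
  + suc k * + suc k * sumTo n (squareTerm n (suc k))
    ≡⟨ *-distribˡ-sumTo n (+ suc k * + suc k) (squareTerm n (suc k)) ⟩
  sumTo n (λ j → + suc k * + suc k * squareTerm n (suc k) j)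
    ≡⟨ sumTo-telescoping n _ _ (squareCertificate n k) refl (squareCertificate-vanishes n k) (squareTerm-recurrence n k) ⟩
  sumTo n (λ j → + suc (n ℕ.+ k) * + suc (n ℕ.+ k) * squareTerm n k j)
    ≡⟨ *-distribˡ-sumTo n (+ suc (n ℕ.+ k) * + suc (n ℕ.+ k)) (squareTerm n k) ⟨
  + suc (n ℕ.+ k) * + suc (n ℕ.+ k) * sumTo n (squareTerm n k)
    ≡⟨ cong (_*_ (+ suc (n ℕ.+ k) * + suc (n ℕ.+ k))) (squareTerm-sum n k) ⟩
  + suc (n ℕ.+ k) * + suc (n ℕ.+ k) * (binom (n ℕ.+ k) k * binom (n ℕ.+ k) k)
    ≡⟨ square-of-product (+ suc (n ℕ.+ k)) (binom (n ℕ.+ k) k) ⟩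
  (+ suc (n ℕ.+ k) * binom (n ℕ.+ k) k) * (+ suc (n ℕ.+ k) * binom (n ℕ.+ k) k)
    ≡⟨ cong (λ x → x * x) absorption ⟨
  (+ suc k * binom (n ℕ.+ suc k) (suc k)) * (+ suc k * binom (n ℕ.+ suc k) (suc k))
    ≡⟨ square-of-product (+ suc k) (binom (n ℕ.+ suc k) (suc k)) ⟨
  + suc k * + suc k * (binom (n ℕ.+ suc k) (suc k) * binom (n ℕ.+ suc k) (suc k)) ∎)
  where
  square-of-product : ∀ a b → a * a * (b * b) ≡ (a * b) * (a * b)
  square-of-product = solve-∀
  absorption : + suc k * binom (n ℕ.+ suc k) (suc k) ≡ + suc (n ℕ.+ k) * binom (n ℕ.+ k) k
  absorption = trans (cong (λ a → + suc k * binom a (suc k)) (ℕₚ.+-suc n k)) (binom-absorption (n ℕ.+ k) k)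

binom-trinomial-revision : ∀ a b c →
  binom (a ℕ.+ b) b * binom (a ℕ.+ b ℕ.+ c) c ≡ binom (a ℕ.+ c) c * binom (a ℕ.+ c ℕ.+ b) b
binom-trinomial-revision a b c = begin
  binom (a ℕ.+ b) b * binom (a ℕ.+ b ℕ.+ c) c           ≡⟨ ℤₚ.pos-* ((a ℕ.+ b) C b) _ ⟨
  + (((a ℕ.+ b) C b) ℕ.* ((a ℕ.+ b ℕ.+ c) C c))         ≡⟨ cong +_ ([a+b]Cb*[a+b+c]Cc≡[a+c]Cc*[a+c+b]Cb a b c) ⟩
  + (((a ℕ.+ c) C c) ℕ.* ((a ℕ.+ c ℕ.+ b) C b))         ≡⟨ ℤₚ.pos-* ((a ℕ.+ c) C c) _ ⟩
  binom (a ℕ.+ c) c * binom (a ℕ.+ c ℕ.+ b) b           ∎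

squareTerm-exchange : ∀ n j k →
  -1ℤ ^ (n ℕ.+ k) * (binom n k * binom (n ℕ.+ k) k) * squareTerm n k j
    ≡ binom n j * binom (n ℕ.+ j) j * (binom n k * alternatingWeight n j (n ℕ.+ j) j k)
squareTerm-exchange n j k = begin
  σ * (binom n k * binom (n ℕ.+ k) k) * (binom n j * binom k j * binom (n ℕ.+ k ℕ.+ j) j)
    ≡⟨ regroup σ (binom n k) (binom n j) (binom k j) (binom (n ℕ.+ k) k) (binom (n ℕ.+ k ℕ.+ j) j) ⟩
  binom n j * (binom n k * (σ * (binom k j * (binom (n ℕ.+ k) k * binom (n ℕ.+ k ℕ.+ j) j))))
    ≡⟨ cong (λ x → binom n j * (binom n k * (σ * (binom k j * x)))) (binom-trinomial-revision n k j) ⟩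
  binom n j * (binom n k * (σ * (binom k j * (binom (n ℕ.+ j) j * binom (n ℕ.+ j ℕ.+ k) k))))
    ≡⟨ regroup′ σ (binom n k) (binom n j) (binom k j) (binom (n ℕ.+ j) j) (binom (n ℕ.+ j ℕ.+ k) k) ⟩
  binom n j * binom (n ℕ.+ j) j * (binom n k * (σ * (binom k j * binom (n ℕ.+ j ℕ.+ k) k)))
    ≡⟨ cong (λ x → binom n j * binom (n ℕ.+ j) j * (binom n k * (σ * (binom k j * + x)))) [n+j+k]Ck≡[n+j+k]C[j+n] ⟩
  binom n j * binom (n ℕ.+ j) j * (binom n k * alternatingWeight n j (n ℕ.+ j) j k) ∎
  where
  σ = -1ℤ ^ (n ℕ.+ k)
  regroup : ∀ σ a b c U V → σ * (a * U) * (b * c * V) ≡ b * (a * (σ * (c * (U * V))))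
  regroup = solve-∀
  regroup′ : ∀ σ a b c U V → b * (a * (σ * (c * (U * V)))) ≡ b * U * (a * (σ * (c * V)))
  regroup′ = solve-∀
  [n+j+k]Ck≡[n+j+k]C[j+n] : (n ℕ.+ j ℕ.+ k) C k ≡ (n ℕ.+ j ℕ.+ k) C (j ℕ.+ n)
  [n+j+k]Ck≡[n+j+k]C[j+n] = trans ([a+b]Cb≡[a+b]Ca (n ℕ.+ j) k) (cong ((n ℕ.+ j ℕ.+ k) C_) (ℕₚ.+-comm n j))

left-summand-factorisation : ∀ n j →
  + ((n C j) ℕ.* (n C j) ℕ.* ((n ℕ.+ j) C n) ℕ.* ((n ℕ.+ 2 ℕ.* j) C n))
    ≡ binom n j * binom (n ℕ.+ j) j * (binom n j * binom (n ℕ.+ j ℕ.+ j) (j ℕ.+ j))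
left-summand-factorisation n j = begin
  + ((n C j) ℕ.* (n C j) ℕ.* ((n ℕ.+ j) C n) ℕ.* ((n ℕ.+ 2 ℕ.* j) C n))
    ≡⟨ cong +_ (regroup (n C j) ((n ℕ.+ j) C n) ((n ℕ.+ 2 ℕ.* j) C n)) ⟩
  + ((n C j) ℕ.* ((n ℕ.+ j) C n) ℕ.* ((n C j) ℕ.* ((n ℕ.+ 2 ℕ.* j) C n)))
    ≡⟨ cong₂ (λ x y → + ((n C j) ℕ.* x ℕ.* ((n C j) ℕ.* y))) (sym ([a+b]Cb≡[a+b]Ca n j)) [n+2j]Cn≡[n+j+j]C[j+j] ⟩
  + ((n C j) ℕ.* ((n ℕ.+ j) C j) ℕ.* ((n C j) ℕ.* ((n ℕ.+ j ℕ.+ j) C (j ℕ.+ j))))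
    ≡⟨ ℤₚ.pos-* ((n C j) ℕ.* ((n ℕ.+ j) C j)) _ ⟩
  + ((n C j) ℕ.* ((n ℕ.+ j) C j)) * + ((n C j) ℕ.* ((n ℕ.+ j ℕ.+ j) C (j ℕ.+ j)))
    ≡⟨ cong₂ _*_ (ℤₚ.pos-* (n C j) _) (ℤₚ.pos-* (n C j) _) ⟩
  binom n j * binom (n ℕ.+ j) j * (binom n j * binom (n ℕ.+ j ℕ.+ j) (j ℕ.+ j)) ∎
  where
  regroup : ∀ a b c → a ℕ.* a ℕ.* b ℕ.* c ≡ a ℕ.* b ℕ.* (a ℕ.* c)
  regroup = ℕ-Solver.solve-∀
  double : ∀ n j → n ℕ.+ 2 ℕ.* j ≡ n ℕ.+ (j ℕ.+ j)
  double = ℕ-Solver.solve-∀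
  [n+2j]Cn≡[n+j+j]C[j+j] : (n ℕ.+ 2 ℕ.* j) C n ≡ (n ℕ.+ j ℕ.+ j) C (j ℕ.+ j)
  [n+2j]Cn≡[n+j+j]C[j+j] = begin
    (n ℕ.+ 2 ℕ.* j) C n          ≡⟨ cong (_C n) (double n j) ⟩
    (n ℕ.+ (j ℕ.+ j)) C n        ≡⟨ [a+b]Cb≡[a+b]Ca n (j ℕ.+ j) ⟨
    (n ℕ.+ (j ℕ.+ j)) C (j ℕ.+ j) ≡⟨ cong (_C (j ℕ.+ j)) (ℕₚ.+-assoc n j j) ⟨
    (n ℕ.+ j ℕ.+ j) C (j ℕ.+ j)  ∎

right-summand-factorisation : ∀ n k →
  (- (+ 1)) ^ (n ℕ.+ k) * (+ ((n C k) ℕ.* (((n ℕ.+ k) C n) ℕ.^ 3)))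
    ≡ -1ℤ ^ (n ℕ.+ k) * (binom n k * binom (n ℕ.+ k) k) * (binom (n ℕ.+ k) k * binom (n ℕ.+ k) k)
right-summand-factorisation n k = begin
  -1ℤ ^ (n ℕ.+ k) * + ((n C k) ℕ.* (((n ℕ.+ k) C n) ℕ.^ 3))
    ≡⟨ cong (λ x → -1ℤ ^ (n ℕ.+ k) * + ((n C k) ℕ.* (x ℕ.^ 3))) ([a+b]Cb≡[a+b]Ca n k) ⟨
  -1ℤ ^ (n ℕ.+ k) * + ((n C k) ℕ.* (((n ℕ.+ k) C k) ℕ.^ 3))
    ≡⟨ cong (λ x → -1ℤ ^ (n ℕ.+ k) * + x) (cube (n C k) ((n ℕ.+ k) C k)) ⟩
  -1ℤ ^ (n ℕ.+ k) * + ((n C k) ℕ.* ((n ℕ.+ k) C k) ℕ.* (((n ℕ.+ k) C k) ℕ.* ((n ℕ.+ k) C k)))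
    ≡⟨ cong (-1ℤ ^ (n ℕ.+ k) *_) (ℤₚ.pos-* ((n C k) ℕ.* ((n ℕ.+ k) C k)) _) ⟩
  -1ℤ ^ (n ℕ.+ k) * (+ ((n C k) ℕ.* ((n ℕ.+ k) C k)) * + (((n ℕ.+ k) C k) ℕ.* ((n ℕ.+ k) C k)))
    ≡⟨ cong₂ (λ x y → -1ℤ ^ (n ℕ.+ k) * (x * y)) (ℤₚ.pos-* (n C k) _) (ℤₚ.pos-* ((n ℕ.+ k) C k) _) ⟩
  -1ℤ ^ (n ℕ.+ k) * (binom n k * binom (n ℕ.+ k) k * (binom (n ℕ.+ k) k * binom (n ℕ.+ k) k))
    ≡⟨ ℤₚ.*-assoc (-1ℤ ^ (n ℕ.+ k)) _ _ ⟨
  -1ℤ ^ (n ℕ.+ k) * (binom n k * binom (n ℕ.+ k) k) * (binom (n ℕ.+ k) k * binom (n ℕ.+ k) k) ∎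
  where
  cube : ∀ a b → a ℕ.* (b ℕ.* (b ℕ.* (b ℕ.* 1))) ≡ a ℕ.* b ℕ.* (b ℕ.* b)
  cube = ℕ-Solver.solve-∀

mainTheorem20 : (n : ℕ) →
    (+ ((2 ℕ.* n) C n)) * sumTo n (λ k → + ((n C k) ℕ.* (n C k) ℕ.* ((n ℕ.+ k) C n) ℕ.* ((n ℕ.+ 2 ℕ.* k) C n)))
    ≡ (+ ((2 ℕ.* n) C n)) * sumTo n (λ k → ((- (+ 1)) ^ (n ℕ.+ k)) * (+ ((n C k) ℕ.* (((n ℕ.+ k) C n) ℕ.^ 3))))
mainTheorem20 n = cong (_*_ (+ ((2 ℕ.* n) C n))) (begin
  sumTo n (λ j → + ((n C j) ℕ.* (n C j) ℕ.* ((n ℕ.+ j) C n) ℕ.* ((n ℕ.+ 2 ℕ.* j) C n)))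
    ≡⟨ sumTo-cong n (left-summand-factorisation n) ⟩
  sumTo n (λ j → u j * (binom n j * binom (n ℕ.+ j ℕ.+ j) (j ℕ.+ j)))
    ≡⟨ sumTo-cong n (λ j → cong (u j *_) (alternating-sum n j (n ℕ.+ j) j)) ⟨
  sumTo n (λ j → u j * sumTo n (a j))
    ≡⟨ sumTo-cong n (λ j → *-distribˡ-sumTo n (u j) (a j)) ⟩
  sumTo n (λ j → sumTo n (λ k → u j * a j k))
    ≡⟨ sumTo-swap n n (λ j k → u j * a j k) ⟩
  sumTo n (λ k → sumTo n (λ j → u j * a j k))
    ≡⟨ sumTo-cong n (λ k → sumTo-cong n (λ j → squareTerm-exchange n j k)) ⟨
  sumTo n (λ k → sumTo n (λ j → v k * squareTerm n k j))
    ≡⟨ sumTo-cong n (λ k → *-distribˡ-sumTo n (v k) (squareTerm n k)) ⟨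
  sumTo n (λ k → v k * sumTo n (squareTerm n k))
    ≡⟨ sumTo-cong n (λ k → cong (v k *_) (squareTerm-sum n k)) ⟩
  sumTo n (λ k → v k * (binom (n ℕ.+ k) k * binom (n ℕ.+ k) k))
    ≡⟨ sumTo-cong n (right-summand-factorisation n) ⟨
  sumTo n (λ k → ((- (+ 1)) ^ (n ℕ.+ k)) * (+ ((n C k) ℕ.* (((n ℕ.+ k) C n) ℕ.^ 3)))) ∎)
  where
  u : ℕ → ℤ
  u j = binom n j * binom (n ℕ.+ j) j
  v : ℕ → ℤ
  v k = -1ℤ ^ (n ℕ.+ k) * (binom n k * binom (n ℕ.+ k) k)
  a : ℕ → ℕ → ℤ
  a j k = binom n k * alternatingWeight n j (n ℕ.+ j) j k
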